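{- The logic $\mathbf{W}$ is sound with respect to the class of all $\mathsf{W}$-PN-frames: every formula belonging to $\mathbf{W}$ is forced at every world of every model based on a $\mathsf{W}$-PN-frame.
   Context: Formulas are built from a countable set $PV$ of propositional variables and $\bot$ by $\land,\lor,\rightarrow$ and a unary modal operator $\mathsf{W}$; $\lnot\varphi$ abbreviates $\varphi\rightarrow\bot$ and $\varphi\leftrightarrow\psi$ abbreviates $(\varphi\to\psi)\land(\psi\to\varphi)$. A PN-frame is a triple $\langle W,\mathcal{N},\leq\rangle$ with $\leq$ a partial order on $W$ and $\mathcal{N}:W\to P(P(W))$. A $\mathsf{W}$-PN-frame is a PN-frame such that for all $w,v\in W$, $X\subseteq W$: if $w\leq v$, $X\in\mathcal{N}_w$ and $v\notin X$, then $X\in\mathcal{N}_v$. A model on such a frame adds $V:PV\to P(W)$ with each $V(q)$ upward closed under $\leq$. Forcing: $w\nVdash\bot$; $w\Vdash q$ iff $w\in V(q)$; $\land,\lor$ pointwise; $w\Vdash\varphi\to\psi$ iff for all $v\geq w$, $v\nVdash\varphi$ or $v\Vdash\psi$; $w\Vdash\mathsf{W}\varphi$ iff $w\Vdash\lnot\varphi$ and $V(\varphi)\in\mathcal{N}_w$, where $V(\varphi)=\{z\in W:z\Vdash\varphi\}$. The logic $\mathbf{W}$ is the smallest set of formulas containing all instances (in this modal language) of the axiom schemes of intuitionistic propositional logic and all instances of $\mathsf{W}\varphi\to\lnot\varphi$, and closed under modus ponens and the rule of extensionality: from $\varphi\leftrightarrow\psi$ infer $\mathsf{W}\varphi\leftrightarrow\mathsf{W}\psi$.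 -}

module Defs where

open import Data.Nat using (ℕ)
open import Data.Product using (_×_; Σ)
open import Data.Sum using (_⊎_)
open import Data.Empty using (⊥)
open import Relation.Nullary using (¬_)
open import Relation.Binary.Bundles using (Poset)
open import Level using (0ℓ; suc)

PV : Set
PV = ℕ

infixr 6 _∧'_
infixr 5 _∨'_
infixr 4 _⇒_

data Form : Set where
  var  : PV → Form
  ⊥'   : Form
  _∧'_ : Form → Form → Form
  _∨'_ : Form → Form → Form
  _⇒_  : Form → Form → Form
  W    : Form → Form

¬' : Form → Form
¬' φ = φ ⇒ ⊥'

_⇔'_ : Form → Form → Form
φ ⇔' ψ = (φ ⇒ ψ) ∧' (ψ ⇒ φ)

Subset : Set → Set₁
Subset A = A → Set

data ⊢W : Form → Set where
  ax-K   : ∀ φ ψ → ⊢W (φ ⇒ (ψ ⇒ φ))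
  ax-S   : ∀ φ ψ χ → ⊢W ((φ ⇒ (ψ ⇒ χ)) ⇒ ((φ ⇒ ψ) ⇒ (φ ⇒ χ)))
  ax-∧I  : ∀ φ ψ → ⊢W (φ ⇒ (ψ ⇒ (φ ∧' ψ)))
  ax-∧E₁ : ∀ φ ψ → ⊢W ((φ ∧' ψ) ⇒ φ)
  ax-∧E₂ : ∀ φ ψ → ⊢W ((φ ∧' ψ) ⇒ ψ)
  ax-∨I₁ : ∀ φ ψ → ⊢W (φ ⇒ (φ ∨' ψ))
  ax-∨I₂ : ∀ φ ψ → ⊢W (ψ ⇒ (φ ∨' ψ))
  ax-∨E  : ∀ φ ψ χ → ⊢W ((φ ⇒ χ) ⇒ ((ψ ⇒ χ) ⇒ ((φ ∨' ψ) ⇒ χ)))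
  ax-⊥E  : ∀ φ → ⊢W (⊥' ⇒ φ)
  ax-W   : ∀ φ → ⊢W (W φ ⇒ ¬' φ)
  mp     : ∀ {φ ψ} → ⊢W (φ ⇒ ψ) → ⊢W φ → ⊢W ψ
  ext    : ∀ {φ ψ} → ⊢W (φ ⇔' ψ) → ⊢W (W φ ⇔' W ψ)

-- Since subsets are predicates, we require 𝒩_w to be
-- closed under extensional equality of subsets (so it is a family of
-- genuine subsets, not of predicate representations).
record PNFrame : Set₂ where
  field
    poset : Poset 0ℓ 0ℓ 0ℓ
  open Poset poset public renaming (Carrier to World)
  field
    𝒩 : World → Subset World → Set
    𝒩-ext : ∀ {w} {X Y : Subset World} →
            (∀ z → X z → Y z) → (∀ z → Y z → X z) → 𝒩 w X → 𝒩 w Y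

IsWFrame : PNFrame → Set₁
IsWFrame F = ∀ {w v} {X : Subset World} → w ≤ v → 𝒩 w X → ¬ X v → 𝒩 v X
  where open PNFrame F

record Model (F : PNFrame) : Set₁ where
  open PNFrame F
  field
    V : PV → Subset World
    V-up : ∀ q {w v} → w ≤ v → V q w → V q v

module _ {F : PNFrame} (M : Model F) where
  open PNFrame F
  open Model M

  infix 3 _⊩_
  _⊩_ : World → Form → Set
  w ⊩ var q   = V q w
  w ⊩ ⊥'      = ⊥
  w ⊩ φ ∧' ψ  = (w ⊩ φ) × (w ⊩ ψ)
  w ⊩ φ ∨' ψ  = (w ⊩ φ) ⊎ (w ⊩ ψ)
  w ⊩ φ ⇒ ψ   = ∀ v → w ≤ v → v ⊩ φ → v ⊩ ψ
  -- first component is  w ⊩ ¬' φ  (= w ⊩ φ ⇒ ⊥') unfolded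
  w ⊩ W φ     = (∀ v → w ≤ v → v ⊩ φ → ⊥) × 𝒩 w (λ z → z ⊩ φ)

-- Persistence: forcing is upward closed along ≤.  For Wφ this is exactly the
-- W-frame condition, since w ⊩ ¬φ and w ≤ v give v ∉ V(φ).  Every axiom is then
-- forced by the usual Kripke argument, and extensionality holds because a
-- forced equivalence makes V(φ) and V(ψ) coincide, while 𝒩_w is extensional.
module Submission where

open import Defs
open import Data.Product using (_,_; proj₁; proj₂)
open import Data.Sum using (inj₁; inj₂)

module _ {F : PNFrame} (M : Model F) where
  open PNFrame F
  open Model M

  infix 3 _⊩ᴹ_
  _⊩ᴹ_ : World → Form → Set
  _⊩ᴹ_ = _⊩_ M

  ⊩-mono : IsWFrame F → ∀ φ {w v} → w ≤ v → w ⊩ᴹ φ → v ⊩ᴹ φ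
  ⊩-mono wf (var q)  w≤v h            = V-up q w≤v h
  ⊩-mono wf ⊥'       w≤v ()
  ⊩-mono wf (φ ∧' ψ) w≤v (a , b)      = ⊩-mono wf φ w≤v a , ⊩-mono wf ψ w≤v b
  ⊩-mono wf (φ ∨' ψ) w≤v (inj₁ a)     = inj₁ (⊩-mono wf φ w≤v a)
  ⊩-mono wf (φ ∨' ψ) w≤v (inj₂ b)     = inj₂ (⊩-mono wf ψ w≤v b)
  ⊩-mono wf (φ ⇒ ψ)  w≤v h u v≤u      = h u (trans w≤v v≤u)
  ⊩-mono wf (W φ) {v = v} w≤v (¬φ , N) =
    (λ u v≤u → ¬φ u (trans w≤v v≤u)) , wf w≤v N (¬φ v w≤v)

  ⊩⇒-apply : ∀ {w} φ ψ → w ⊩ᴹ φ ⇒ ψ → w ⊩ᴹ φ → w ⊩ᴹ ψ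
  ⊩⇒-apply {w} _ _ h = h w refl

  W-cong : ∀ {w} φ ψ → (∀ z → z ⊩ᴹ φ → z ⊩ᴹ ψ) → (∀ z → z ⊩ᴹ ψ → z ⊩ᴹ φ) →
           w ⊩ᴹ W φ → w ⊩ᴹ W ψ
  W-cong _ _ φ⊆ψ ψ⊆φ (¬φ , N) = (λ u w≤u b → ¬φ u w≤u (ψ⊆φ u b)) , 𝒩-ext φ⊆ψ ψ⊆φ N

  soundness : IsWFrame F → ∀ {φ} → ⊢W φ → ∀ w → w ⊩ᴹ φ
  soundness wf (ax-K φ ψ)     _ _ _ a u v≤u _ = ⊩-mono wf φ v≤u a
  soundness wf (ax-S φ ψ χ)   _ _ _ f u v≤u g x u≤x a =
    f x (trans v≤u u≤x) a x refl (g x u≤x a)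
  soundness wf (ax-∧I φ ψ)    _ _ _ a u v≤u b = ⊩-mono wf φ v≤u a , b
  soundness wf (ax-∧E₁ φ ψ)   _ _ _ (a , _) = a
  soundness wf (ax-∧E₂ φ ψ)   _ _ _ (_ , b) = b
  soundness wf (ax-∨I₁ φ ψ)   _ _ _ a = inj₁ a
  soundness wf (ax-∨I₂ φ ψ)   _ _ _ b = inj₂ b
  soundness wf (ax-∨E φ ψ χ)  _ _ _ f u v≤u g x u≤x (inj₁ a) = f x (trans v≤u u≤x) a
  soundness wf (ax-∨E φ ψ χ)  _ _ _ f u v≤u g x u≤x (inj₂ b) = g x u≤x b
  soundness wf (ax-⊥E φ)      _ _ _ ()
  soundness wf (ax-W φ)       _ _ _ (¬φ , _) = ¬φ
  soundness wf (mp {φ} {ψ} d e) w =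
    ⊩⇒-apply φ ψ (soundness wf d w) (soundness wf e w)
  soundness wf (ext {φ} {ψ} d) _ =
    (λ _ _ → W-cong φ ψ φ⊆ψ ψ⊆φ) , (λ _ _ → W-cong ψ φ ψ⊆φ φ⊆ψ)
    where
      φ⊆ψ : ∀ z → z ⊩ᴹ φ → z ⊩ᴹ ψ
      φ⊆ψ z = ⊩⇒-apply φ ψ (proj₁ (soundness wf d z))
      ψ⊆φ : ∀ z → z ⊩ᴹ ψ → z ⊩ᴹ φ
      ψ⊆φ z = ⊩⇒-apply ψ φ (proj₂ (soundness wf d z))

mainTheorem2 : (F : PNFrame) → IsWFrame F → (M : Model F) →
    (φ : Form) → ⊢W φ → (w : PNFrame.World F) → _⊩_ M w φ
mainTheorem2 F wf M φ d = soundness M wf d
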